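{- Let $G=(V,E)$ be a graph, $e\in E$ and $\alpha\in(0,1]$. Then $\mathrm{pd}_\alpha(G)\le \mathrm{pd}_\alpha(G-e)\le \mathrm{pd}_\alpha(G)+1$.
   Context: All graphs are finite and simple. For a graph $G=(V,E)$ and $S\subseteq V$, $N[S]$ denotes the closed neighbourhood of $S$. For $0<\alpha\le 1$, a set $S\subseteq V$ is an $\alpha$-partial dominating set if $|N[S]|\ge \alpha|V|$; $\mathrm{pd}_\alpha(G)$ is the minimum size of an $\alpha$-partial dominating set. $G-e$ is the graph obtained by deleting the edge $e$ (keeping all vertices).
   Formalization: The parameter α ranges over the rationals in (0,1]. -}

module Defs where

open import Data.Bool using (Bool; true; false; _∧_; _∨_; not)
open import Data.Nat using (ℕ; zero; suc; _≤_)
open import Data.Fin using (Fin; zero; suc; _≟_)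
open import Data.Fin.Subset using (Subset; ∣_∣)
open import Data.Vec using (Vec; tabulate; lookup)
open import Data.Product using (Σ; _×_; _,_)
open import Data.Rational using (ℚ; _≤_; _*_; _/_)
open import Relation.Nullary.Decidable using (⌊_⌋)
open import Relation.Binary.PropositionalEquality using (_≡_)

record Graph (n : ℕ) : Set where
  field
    adj   : Fin n → Fin n → Bool
    sym   : ∀ u v → adj u v ≡ adj v u
    irrefl : ∀ v → adj v v ≡ false
open Graph public

anyFin : ∀ {n} → (Fin n → Bool) → Bool
anyFin {zero}  f = false
anyFin {suc n} f = f zero ∨ anyFin (λ i → f (suc i))

deleteEdge : ∀ {n} → Graph n → Fin n → Fin n → Graph n
deleteEdge {n} G a b = record
  { adj = adj'
  ; sym = sym'
  ; irrefl = irr' }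
  where
    isE : Fin n → Fin n → Bool
    isE u v = (⌊ u ≟ a ⌋ ∧ ⌊ v ≟ b ⌋) ∨ (⌊ u ≟ b ⌋ ∧ ⌊ v ≟ a ⌋)
    adj' : Fin n → Fin n → Bool
    adj' u v = adj G u v ∧ not (isE u v)
    isE-sym : ∀ u v → isE u v ≡ isE v u
    isE-sym u v with ⌊ u ≟ a ⌋ | ⌊ v ≟ b ⌋ | ⌊ u ≟ b ⌋ | ⌊ v ≟ a ⌋
    ... | true  | true  | true  | true  = _≡_.refl
    ... | true  | true  | true  | false = _≡_.refl
    ... | true  | true  | false | true  = _≡_.refl
    ... | true  | true  | false | false = _≡_.refl
    ... | true  | false | true  | true  = _≡_.refl
    ... | true  | false | true  | false = _≡_.refl
    ... | true  | false | false | true  = _≡_.refl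
    ... | true  | false | false | false = _≡_.refl
    ... | false | true  | true  | true  = _≡_.refl
    ... | false | true  | true  | false = _≡_.refl
    ... | false | true  | false | true  = _≡_.refl
    ... | false | true  | false | false = _≡_.refl
    ... | false | false | true  | true  = _≡_.refl
    ... | false | false | true  | false = _≡_.refl
    ... | false | false | false | true  = _≡_.refl
    ... | false | false | false | false = _≡_.refl
    sym' : ∀ u v → adj' u v ≡ adj' v u
    sym' u v rewrite sym G u v | isE-sym u v = _≡_.refl
    irr' : ∀ v → adj' v v ≡ false
    irr' v rewrite irrefl G v = _≡_.refl

closedNbhd : ∀ {n} → Graph n → Subset n → Subset n
closedNbhd G S = tabulate λ v →
  anyFin λ u → lookup S u ∧ (⌊ u ≟ v ⌋ ∨ adj G u v)

IsPartialDom : ∀ {n} → Graph n → ℚ → Subset n → Set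
IsPartialDom {n} G α S = α * (Data.Rational._/_ (Data.Integer.+_ n) 1) Data.Rational.≤ (Data.Rational._/_ (Data.Integer.+_ ∣ closedNbhd G S ∣) 1)
  where import Data.Integer

IsPd : ∀ {n} → Graph n → ℚ → ℕ → Set
IsPd G α k =
  Σ (Subset _) (λ S → IsPartialDom G α S × ∣ S ∣ ≡ k)
  × (∀ S → IsPartialDom G α S → k Data.Nat.≤ ∣ S ∣)

-- Both inequalities are instances of one comparison principle
-- (pd-comparison): if every vertex set S can be traded for a set T whose closed neighbourhood in G contains N_H[S] and with
-- |T| ≤ |S| + c, then pd_α(G) ≤ pd_α(H) + c: trade a minimum set of H, and
-- note that partial domination only depends on the size of N[S], so
-- enlarging N[S] preserves it (partialDom-transfer).
--   * G - e is a spanning subgraph of G, so N_{G-e}[S] ⊆ N_G[S]; take T = S.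
--   * Removing e = ab only loses coverage along e itself.  Adding to S the
--     endpoint of e that S is missing (b if a ∈ S, a otherwise) restores it:
--     N_G[S] ⊆ N_{G-e}[S ∪ {x}]; take T = S ∪ {x}, so c = 1.
-- The file first translates the Boolean definitions of Defs (anyFin,
-- closedNbhd, deleteEdge) into propositions, then proves the two
-- neighbourhood inclusions, and derives the theorem from pd-comparison.
module Submission where

open import Defs
open import Data.Bool using (Bool; true; false; _∧_; _∨_)
open import Data.Bool.Properties using (∧-conicalˡ; ∧-conicalʳ; ∧-identityʳ)
open import Data.Nat using (ℕ; suc; _≤_; _+_; s≤s)
open import Data.Nat.Properties using (≤-refl; ≤-trans; m≤m+n; n≤1+n; +-comm; +-identityʳ)
open import Data.Fin using (Fin; zero; suc; _≟_)
open import Data.Fin.Subset using (Subset; ∣_∣; _∈_; _⊆_; _∪_; ⁅_⁆; inside; outside)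
open import Data.Fin.Subset.Properties
  using (_∈?_; p⊆q⇒∣p∣≤∣q∣; p⊆p∪q; x∈p∪q⁺; x∈⁅x⁆; ∪-identityʳ)
open import Data.Vec using (_∷_; lookup)
open import Data.Vec.Properties using (lookup∘tabulate; lookup⇒[]=; []=⇒lookup)
open import Data.Product using (Σ; _×_; _,_)
open import Data.Sum using (_⊎_; inj₁; inj₂)
open import Data.Integer using (+_; +≤+) renaming (_≤_ to _≤ℤ_)
open import Data.Integer.Properties using (*-identityʳ)
open import Data.Rational using (ℚ; 0ℚ; 1ℚ; _<_; mkℚ; *≤*)
open import Data.Rational.Properties using (normalize-coprime) renaming (≤-trans to ≤ℚ-trans)
import Data.Rational
open import Data.Nat.Coprimality using (1-coprimeTo) renaming (sym to coprime-sym)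
open import Relation.Nullary using (yes; no)
open import Relation.Nullary.Decidable using (⌊_⌋)
open import Data.Empty using (⊥-elim)
open import Relation.Binary.PropositionalEquality
  using (_≡_; refl; trans; subst; subst₂) renaming (sym to ≡-sym)

∨-true : ∀ {x y} → x ∨ y ≡ true → x ≡ true ⊎ y ≡ true
∨-true {true}  _ = inj₁ refl
∨-true {false} p = inj₂ p

≟-sound : ∀ {n} {u v : Fin n} → ⌊ u ≟ v ⌋ ≡ true → u ≡ v
≟-sound {u = u} {v} p with u ≟ v
... | yes u≡v = u≡v

anyFin-witness : ∀ {n} (f : Fin n → Bool) → anyFin f ≡ true → Σ (Fin n) λ u → f u ≡ true
anyFin-witness {suc n} f p with f zero in f0
... | true  = zero , f0
... | false with anyFin-witness (λ i → f (suc i)) p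
...   | u , fu = suc u , fu

anyFin-intro : ∀ {n} (f : Fin n → Bool) u → f u ≡ true → anyFin f ≡ true
anyFin-intro f zero    fu rewrite fu = refl
anyFin-intro f (suc u) fu with f zero
... | true  = refl
... | false = anyFin-intro (λ i → f (suc i)) u fu

Near : ∀ {n} → Graph n → Fin n → Fin n → Set
Near G u v = u ≡ v ⊎ adj G u v ≡ true

∈N⁻ : ∀ {n} (G : Graph n) (S : Subset n) {v} → v ∈ closedNbhd G S →
      Σ (Fin n) λ u → u ∈ S × Near G u v
∈N⁻ G S {v} v∈N
  with anyFin-witness _ (trans (≡-sym (lookup∘tabulate _ v)) ([]=⇒lookup v∈N))
... | u , hit = u , lookup⇒[]= u S (∧-conicalˡ _ _ hit) , near (∨-true (∧-conicalʳ _ _ hit))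
  where
  near : ⌊ u ≟ v ⌋ ≡ true ⊎ adj G u v ≡ true → Near G u v
  near (inj₁ u≟v) = inj₁ (≟-sound u≟v)
  near (inj₂ uv)  = inj₂ uv

∈N⁺ : ∀ {n} (G : Graph n) (S : Subset n) {u v} → u ∈ S → Near G u v → v ∈ closedNbhd G S
∈N⁺ G S {u} {v} u∈S near =
  lookup⇒[]= v _ (trans (lookup∘tabulate _ v) (anyFin-intro _ u (hit near)))
  where
  hit : Near G u v → lookup S u ∧ (⌊ u ≟ v ⌋ ∨ adj G u v) ≡ true
  hit near rewrite []=⇒lookup u∈S with u ≟ v | near
  ... | yes _   | _         = refl
  ... | no u≢v  | inj₁ u≡v  = ⊥-elim (u≢v u≡v)
  ... | no _    | inj₂ uv   = uv

closedNbhd-subgraph : ∀ {n} (H G : Graph n) →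
  (∀ u v → adj H u v ≡ true → adj G u v ≡ true) →
  ∀ S → closedNbhd H S ⊆ closedNbhd G S
closedNbhd-subgraph H G H⊆G S v∈N with ∈N⁻ H S v∈N
... | u , u∈S , inj₁ u≡v = ∈N⁺ G S u∈S (inj₁ u≡v)
... | u , u∈S , inj₂ uv  = ∈N⁺ G S u∈S (inj₂ (H⊆G u _ uv))

deleteEdge-⊆ : ∀ {n} (G : Graph n) a b u v →
  adj (deleteEdge G a b) u v ≡ true → adj G u v ≡ true
deleteEdge-⊆ G a b u v = ∧-conicalˡ (adj G u v) _

deleteEdge-keeps : ∀ {n} (G : Graph n) a b u v → adj G u v ≡ true →
  adj (deleteEdge G a b) u v ≡ true ⊎ ((u ≡ a × v ≡ b) ⊎ (u ≡ b × v ≡ a))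
deleteEdge-keeps G a b u v uv
  with ⌊ u ≟ a ⌋ ∧ ⌊ v ≟ b ⌋ in isAB | ⌊ u ≟ b ⌋ ∧ ⌊ v ≟ a ⌋ in isBA
... | true  | _     = inj₂ (inj₁ (≟-sound (∧-conicalˡ _ _ isAB) , ≟-sound (∧-conicalʳ _ _ isAB)))
... | false | true  = inj₂ (inj₂ (≟-sound (∧-conicalˡ _ _ isBA) , ≟-sound (∧-conicalʳ _ _ isBA)))
... | false | false = inj₁ (trans (∧-identityʳ (adj G u v)) uv)

x∈p∪⁅x⁆ : ∀ {n} (p : Subset n) x → x ∈ p ∪ ⁅ x ⁆
x∈p∪⁅x⁆ p x = x∈p∪q⁺ (inj₂ (x∈⁅x⁆ x))

-- Repairing a deleted edge ab: if T ⊇ S contains the other endpoint of ab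
-- whenever S contains one, then T dominates in G - ab all that S dominates
-- in G (a vertex reached only along ab is now in T itself).

closedNbhd-deleteEdge : ∀ {n} (G : Graph n) a b (S T : Subset n) → S ⊆ T →
  (a ∈ S → b ∈ T) → (b ∈ S → a ∈ T) →
  closedNbhd G S ⊆ closedNbhd (deleteEdge G a b) T
closedNbhd-deleteEdge G a b S T S⊆T a↦b b↦a v∈N with ∈N⁻ G S v∈N
... | u , u∈S , inj₁ u≡v = ∈N⁺ (deleteEdge G a b) T (S⊆T u∈S) (inj₁ u≡v)
... | u , u∈S , inj₂ uv with deleteEdge-keeps G a b u _ uv
...   | inj₁ uv′                  = ∈N⁺ (deleteEdge G a b) T (S⊆T u∈S) (inj₂ uv′)
...   | inj₂ (inj₁ (refl , refl)) = ∈N⁺ (deleteEdge G a b) T (a↦b u∈S) (inj₁ refl)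
...   | inj₂ (inj₂ (refl , refl)) = ∈N⁺ (deleteEdge G a b) T (b↦a u∈S) (inj₁ refl)

missingEndpoint : ∀ {n} (a b : Fin n) → Subset n → Fin n
missingEndpoint a b S with a ∈? S
... | yes _ = b
... | no _  = a

addEndpoint-repairs : ∀ {n} (G : Graph n) a b (S : Subset n) →
  closedNbhd G S ⊆ closedNbhd (deleteEdge G a b) (S ∪ ⁅ missingEndpoint a b S ⁆)
addEndpoint-repairs G a b S with a ∈? S
... | yes a∈S = closedNbhd-deleteEdge G a b S _ (p⊆p∪q _) (λ _ → x∈p∪⁅x⁆ S b) (λ _ → p⊆p∪q _ a∈S)
... | no a∉S  = closedNbhd-deleteEdge G a b S _ (p⊆p∪q _) (λ a∈S → ⊥-elim (a∉S a∈S)) (λ _ → x∈p∪⁅x⁆ S a)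

∣p∪⁅x⁆∣≤1+∣p∣ : ∀ {n} (p : Subset n) x → ∣ p ∪ ⁅ x ⁆ ∣ ≤ suc ∣ p ∣
∣p∪⁅x⁆∣≤1+∣p∣ (inside  ∷ p) zero    rewrite ∪-identityʳ p = n≤1+n _
∣p∪⁅x⁆∣≤1+∣p∣ (outside ∷ p) zero    rewrite ∪-identityʳ p = ≤-refl
∣p∪⁅x⁆∣≤1+∣p∣ (inside  ∷ p) (suc x) = s≤s (∣p∪⁅x⁆∣≤1+∣p∣ p x)
∣p∪⁅x⁆∣≤1+∣p∣ (outside ∷ p) (suc x) = ∣p∪⁅x⁆∣≤1+∣p∣ p x

/1-normal : ∀ m → + m Data.Rational./ 1 ≡ mkℚ (+ m) 0 (coprime-sym (1-coprimeTo m))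
/1-normal m = normalize-coprime _

ℕ→ℚ-mono : ∀ {m m′} → m ≤ m′ → (+ m Data.Rational./ 1) Data.Rational.≤ (+ m′ Data.Rational./ 1)
ℕ→ℚ-mono {m} {m′} m≤m′ rewrite /1-normal m | /1-normal m′ =
  *≤* (subst₂ _≤ℤ_ (≡-sym (*-identityʳ (+ m))) (≡-sym (*-identityʳ (+ m′))) (+≤+ m≤m′))

-- Being α-partially dominating depends only on |N[S]|, so it transfers to
-- any set (in any graph on the same vertices) with a larger neighbourhood.

partialDom-transfer : ∀ {n} (G H : Graph n) α (S T : Subset n) →
  IsPartialDom G α S → closedNbhd G S ⊆ closedNbhd H T → IsPartialDom H α T
partialDom-transfer G H α S T domS N⊆N =
  ≤ℚ-trans domS (ℕ→ℚ-mono (p⊆q⇒∣p∣≤∣q∣ N⊆N))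

pd-comparison : ∀ {n} (G H : Graph n) α c k k′ → IsPd G α k → IsPd H α k′ →
  (∀ S → Σ (Subset n) λ T → closedNbhd H S ⊆ closedNbhd G T × ∣ T ∣ ≤ ∣ S ∣ + c) →
  k ≤ k′ + c
pd-comparison G H α c k k′ (_ , minimalG) ((S , domS , ∣S∣≡k′) , _) trade with trade S
... | T , N⊆N , ∣T∣≤∣S∣+c =
  ≤-trans (minimalG T (partialDom-transfer H G α S T domS N⊆N))
          (subst (λ m → ∣ T ∣ ≤ m + c) ∣S∣≡k′ ∣T∣≤∣S∣+c)

-- Main theorem.

mainTheorem11 : ∀ {n} (G : Graph n) (a b : Fin n) → adj G a b ≡ true →
    (α : ℚ) → 0ℚ < α → α Data.Rational.≤ 1ℚ →
    (k k′ : ℕ) → IsPd G α k → IsPd (deleteEdge G a b) α k′ →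
    k ≤ k′ × k′ ≤ k + 1
mainTheorem11 G a b _ α _ _ k k′ pdG pdG-e = lower , upper
  where
  lower : k ≤ k′
  lower = subst (k ≤_) (+-identityʳ k′) (pd-comparison G (deleteEdge G a b) α 0 k k′ pdG pdG-e
    λ S → S , closedNbhd-subgraph (deleteEdge G a b) G (deleteEdge-⊆ G a b) S , m≤m+n ∣ S ∣ 0)
  upper : k′ ≤ k + 1
  upper = pd-comparison (deleteEdge G a b) G α 1 k′ k pdG-e pdG
    λ S → S ∪ ⁅ missingEndpoint a b S ⁆ , addEndpoint-repairs G a b S
        , subst (∣ S ∪ ⁅ missingEndpoint a b S ⁆ ∣ ≤_) (+-comm 1 ∣ S ∣) (∣p∪⁅x⁆∣≤1+∣p∣ S _)
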